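{- Let $T$ be a finite vertex-colored arborescence with colors in $\mathbb{N}$, and let $<_V$ be a total ordering of $V(T)$. Then there exists a unique total ordering $<_T$ of $V(T)$ such that $<_T$ is a depth-first search order of $T$ and, for any two siblings $u$ and $v$, $u<_T v$ if and only if either $T[u]<_{\mathcal{T}_{\mathbb{N}}}T[v]$, or $T[u]=_{\mathcal{T}_{\mathbb{N}}}T[v]$ and $u<_V v$.
   Context: A vertex-colored arborescence is a finite directed tree $T$ with a root $r$ such that every edge is directed away from $r$, together with a coloring $c:V(T)\to\mathbb{N}$ (not necessarily proper). Siblings are distinct vertices with the same parent. For $v\in V(T)$, $T[v]$ denotes the subarborescence consisting of $v$ and all its descendants, rooted at $v$, with inherited colors. A depth-first search order of $T$ is a preorder traversal from the root: each vertex precedes all its descendants, and for each vertex $v$ the vertices of $T[v]$ form a contiguous block. Arrays are compared lexicographically: $x<y$ iff there is an index $i$ with $x[j]=y[j]$ for all $j<i$ and either $x[i]<y[i]$ (entries being integers or arrays compared recursively), or $x$ has length $i$ while $y$ is longer. The array $\mathrm{L}\mathcal{D}_A$ is defined recursively: if $u$ has no children, $\mathrm{L}\mathcal{D}_A(T[u])=[[\,]]$; otherwise, list the children of $u$ as $n_1,\dots,n_k$ sorted so that $n_a$ precedes $n_b$ whenever $c(n_a)<c(n_b)$, or $c(n_a)=c(n_b)$ and $\mathrm{L}\mathcal{D}_A(T[n_a])<\mathrm{L}\mathcal{D}_A(T[n_b])$ (ties arbitrary), and set $\mathrm{L}\mathcal{D}_A(T[u])=[[c(n_1),\dots,c(n_k)]]+\mathrm{L}\mathcal{D}_A(T[n_1])+\cdots+\mathrm{L}\mathcal{D}_A(T[n_k])$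 ($+$ is concatenation). For an arborescence $S$ with root $s$, $\overline{\mathrm{L}\mathcal{D}_A}(S)=[[c(s)]]+\mathrm{L}\mathcal{D}_A(S)$. For arborescences $S_1,S_2$, $S_1<_{\mathcal{T}_{\mathbb{N}}}S_2$ means $\overline{\mathrm{L}\mathcal{D}_A}(S_1)<\overline{\mathrm{L}\mathcal{D}_A}(S_2)$ and $S_1=_{\mathcal{T}_{\mathbb{N}}}S_2$ means $\overline{\mathrm{L}\mathcal{D}_A}(S_1)=\overline{\mathrm{L}\mathcal{D}_A}(S_2)$. -}

module Defs where

open import Data.Nat using (ℕ; zero; suc) renaming (_<_ to _<ℕ_; _<?_ to _<ℕ?_)
open import Data.Nat.Properties using () renaming (_≟_ to _≟ℕ_)
open import Data.Fin using (Fin)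
open import Data.Fin.Properties using () renaming (_≟_ to _≟F_)
open import Data.List using (List; []; _∷_; _++_; [_]; map; concatMap; filter; allFin)
open import Data.List.Properties using (≡-dec)
open import Data.List.Relation.Binary.Lex.Strict using (Lex-<; <-decidable)
open import Data.Maybe using (Maybe; just; nothing)
open import Data.Maybe.Properties using () renaming (≡-dec to ≡-decM)
open import Data.Product using (_×_; _,_; ∃)
open import Data.Sum using (_⊎_)
open import Data.Bool using (Bool; true; false; if_then_else_; _∨_; _∧_)
open import Relation.Nullary using (¬_; ⌊_⌋)
open import Relation.Binary.PropositionalEquality using (_≡_)
open import Relation.Binary.Core using (Rel)
open import Relation.Binary.Structures using (IsStrictTotalOrder)
open import Function.Bundles using (_⇔_)

-- Arborescences on the vertex set Fin n, given by a parent function.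
-- The edges are  p ↦ v  whenever  parent v ≡ just p  (directed away from the root).

data Desc {n : ℕ} (parent : Fin n → Maybe (Fin n)) (u : Fin n) : Fin n → Set where
  here : Desc parent u u
  step : ∀ {v w} → Desc parent u v → parent w ≡ just v → Desc parent u w

-- A finite arborescence: the root has no parent and every vertex is reachable
-- from the root along edges.  (This forces acyclicity and that every non-root
-- vertex has exactly one parent, i.e. a finite directed tree rooted at root.)
record Arborescence (n : ℕ) : Set where
  field
    root        : Fin n
    parent      : Fin n → Maybe (Fin n)
    root-parent : parent root ≡ nothing
    reach       : ∀ v → Desc parent root v

Array₁ : Set
Array₁ = List ℕ

Array₂ : Set
Array₂ = List (List ℕ)

_<₁_ : Rel Array₁ _
_<₁_ = Lex-< _≡_ _<ℕ_

_<₂_ : Rel Array₂ _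
_<₂_ = Lex-< _≡_ _<₁_

_<₁?_ : ∀ x y → Bool
x <₁? y = ⌊ <-decidable _≟ℕ_ _<ℕ?_ x y ⌋

_<₂?_ : ∀ x y → Bool
x <₂? y = ⌊ <-decidable (≡-dec _≟ℕ_) (<-decidable _≟ℕ_ _<ℕ?_) x y ⌋

_==₂_ : Array₂ → Array₂ → Bool
x ==₂ y = ⌊ ≡-dec (≡-dec _≟ℕ_) x y ⌋

module _ {n : ℕ} (T : Arborescence n) (c : Fin n → ℕ) where
  open Arborescence T

  children : Fin n → List (Fin n)
  children u = filter (λ v → ≡-decM _≟F_ (parent v) (just u)) (allFin n)

  keyLt : (ℕ × Array₂) → (ℕ × Array₂) → Bool
  keyLt (a , A) (b , B) = ⌊ a <ℕ? b ⌋ ∨ (⌊ a ≟ℕ b ⌋ ∧ (A <₂? B))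

  insertBy : (Fin n → ℕ × Array₂) → Fin n → List (Fin n) → List (Fin n)
  insertBy k x []       = x ∷ []
  insertBy k x (y ∷ ys) = if keyLt (k y) (k x) then y ∷ insertBy k x ys else x ∷ y ∷ ys

  sortBy : (Fin n → ℕ × Array₂) → List (Fin n) → List (Fin n)
  sortBy k []       = []
  sortBy k (x ∷ xs) = insertBy k x (sortBy k xs)

  -- For a leaf the value is
  -- [[]] for every fuel; fuel n (the number of vertices) exceeds the height of
  -- every subarborescence, so LDA-fuel n u is LD_A(T[u]).
  LDA-fuel : ℕ → Fin n → Array₂
  LDA-fuel zero    u = [] ∷ []
  LDA-fuel (suc f) u =
    let ch = sortBy (λ v → c v , LDA-fuel f v) (children u)
    in map c ch ∷ concatMap (LDA-fuel f) ch

  LDA : Fin n → Array₂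
  LDA u = LDA-fuel n u

  LDAbar : Fin n → Array₂
  LDAbar u = (c u ∷ []) ∷ LDA u

  _<ᵀ_ : Fin n → Fin n → Set
  u <ᵀ v = LDAbar u <₂ LDAbar v

  _=ᵀ_ : Fin n → Fin n → Set
  u =ᵀ v = LDAbar u ≡ LDAbar v

  Siblings : Fin n → Fin n → Set
  Siblings u v = ¬ (u ≡ v) × ∃ λ p → parent u ≡ just p × parent v ≡ just p

  IsDFSOrder : Rel (Fin n) _ → Set
  IsDFSOrder R =
    (∀ u v → Desc parent u v → ¬ (u ≡ v) → R u v)
    × (∀ v x y w → Desc parent v x → Desc parent v y → R x w → R w y → Desc parent v w)

  SiblingRule : Rel (Fin n) _ → Rel (Fin n) _ → Set
  SiblingRule _<V_ R = ∀ u v → Siblings u v →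
    (R u v ⇔ (u <ᵀ v ⊎ (u =ᵀ v × u <V v)))

  IsCanonicalOrder : Rel (Fin n) _ → Rel (Fin n) _ → Set
  IsCanonicalOrder _<V_ R =
    IsStrictTotalOrder _≡_ R × IsDFSOrder R × SiblingRule _<V_ R

{-# OPTIONS --safe #-}
-- Order the vertices by their paths from the root, compared lexicographically
-- with siblings ordered by the key (LD̄_A, <_V).  A subarborescence T[v] consists
-- exactly of the vertices whose root path extends that of v, and such a set is an
-- interval of the lexicographic order; this gives the depth-first property, and two
-- siblings are compared by their last entries only.  Conversely, a canonical order R
-- contains this one: if the root path of u is a proper prefix of that of v then u is
-- an ancestor of v; otherwise the paths diverge at siblings a ≺ b above u and v, and
-- v R u would place b between a and u, hence inside T[a], which is impossible.
module Submission where

open import Defs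
open import Data.Fin using (Fin; _≟_)
open import Data.List using (List; []; _∷_; _++_; [_]; _∷ʳ_; initLast; _∷ʳ′_)
open import Data.List.Properties
  using (++-assoc; ++-cancelˡ; ++-conicalʳ; ++-identityʳ; ∷ʳ-injective; ∷ʳ-injectiveˡ; ∷ʳ-injectiveʳ; ∷-injectiveˡ; ∷-injectiveʳ)
open import Data.List.Relation.Binary.Lex.Core using (base; halt; this; next)
open import Data.List.Relation.Binary.Lex.Strict using (Lex-<)
import Data.List.Relation.Binary.Lex.Strict as Lex
open import Data.List.Relation.Binary.Pointwise using (Pointwise-≡⇒≡)
open import Data.Maybe using (just; nothing)
open import Data.Maybe.Properties using (just-injective)
open import Data.Nat using (ℕ)
import Data.Nat.Properties as ℕ
open import Data.Product using (_×_; ∃; _,_; proj₁; proj₂; map₂)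
open import Data.Product.Relation.Binary.Lex.Strict using (×-Lex; ×-isStrictTotalOrder)
open import Data.Product.Relation.Binary.Pointwise.NonDependent using (≡×≡⇒≡)
open import Data.Sum using (_⊎_; inj₁; inj₂)
open import Function.Base using (_∘_; _on_)
open import Function.Bundles using (_⇔_; mk⇔; Equivalence)
open import Function.Definitions using (Injective)
open import Level using (Level; _⊔_; 0ℓ)
open import Relation.Binary.Core using (Rel; _⇒_)
open import Relation.Binary.Definitions using (Transitive; Trichotomous; tri<; tri≈; tri>)
open import Relation.Binary.Structures using (IsStrictPartialOrder; IsStrictTotalOrder)
import Relation.Binary.Construct.On as On
open import Relation.Binary.PropositionalEquality
  using (_≡_; _≢_; refl; sym; trans; cong; subst; subst₂; resp₂; isEquivalence; module ≡-Reasoning)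
open import Relation.Nullary using (¬_; yes; no; contradiction)

private
  variable
    a b ℓ ℓ₁ ℓ₂ : Level
    A : Set a
    B : Set b

isStrictTotalOrder-≡ : {_≈_ : Rel A ℓ₁} {_<_ : Rel A ℓ₂} →
  _≈_ ⇒ _≡_ → IsStrictTotalOrder _≈_ _<_ → IsStrictTotalOrder _≡_ _<_
isStrictTotalOrder-≡ {_<_ = _<_} ≈⇒≡ sto = record
  { isStrictPartialOrder = record
    { isEquivalence = isEquivalence
    ; irrefl        = λ { refl → S.irrefl S.Eq.refl }
    ; trans         = S.trans
    ; <-resp-≈      = resp₂ _<_
    }
  ; compare = compare
  }
  where
  module S = IsStrictTotalOrder sto

  compare : Trichotomous _≡_ _<_
  compare x y with S.compare x y
  ... | tri< x<y x≉y y≮x = tri< x<y (x≉y ∘ S.Eq.reflexive) y≮x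
  ... | tri≈ x≮y x≈y y≮x = tri≈ x≮y (≈⇒≡ x≈y) y≮x
  ... | tri> x≮y x≉y y<x = tri> x≮y (x≉y ∘ S.Eq.reflexive) y<x

on-isStrictTotalOrder-≡ : {_<_ : Rel A ℓ} (f : B → A) → Injective _≡_ _≡_ f →
  IsStrictTotalOrder _≡_ _<_ → IsStrictTotalOrder _≡_ (_<_ on f)
on-isStrictTotalOrder-≡ f f-injective sto = isStrictTotalOrder-≡ f-injective (On.isStrictTotalOrder f sto)

Lex-<-isStrictTotalOrder-≡ : {_<_ : Rel A ℓ} →
  IsStrictTotalOrder _≡_ _<_ → IsStrictTotalOrder _≡_ (Lex-< _≡_ _<_)
Lex-<-isStrictTotalOrder-≡ sto = isStrictTotalOrder-≡ Pointwise-≡⇒≡ (Lex.<-isStrictTotalOrder sto)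

×-Lex-isStrictTotalOrder-≡ : {_<₁_ : Rel A ℓ₁} {_<₂_ : Rel B ℓ₂} →
  IsStrictTotalOrder _≡_ _<₁_ → IsStrictTotalOrder _≡_ _<₂_ →
  IsStrictTotalOrder _≡_ (×-Lex _≡_ _<₁_ _<₂_)
×-Lex-isStrictTotalOrder-≡ sto₁ sto₂ = isStrictTotalOrder-≡ ≡×≡⇒≡ (×-isStrictTotalOrder sto₁ sto₂)

<₂-isStrictTotalOrder : IsStrictTotalOrder _≡_ _<₂_
<₂-isStrictTotalOrder = Lex-<-isStrictTotalOrder-≡ (Lex-<-isStrictTotalOrder-≡ ℕ.<-isStrictTotalOrder)

strictTotalOrder-maximal : {_<_ : Rel A ℓ₁} {_⊏_ : Rel A ℓ₂} →
  IsStrictTotalOrder _≡_ _<_ → IsStrictPartialOrder _≡_ _⊏_ → _<_ ⇒ _⊏_ → _⊏_ ⇒ _<_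
strictTotalOrder-maximal <-sto ⊏-spo <⇒⊏ {x} {y} x⊏y with IsStrictTotalOrder.compare <-sto x y
... | tri< x<y _ _ = x<y
... | tri≈ _ refl _ = contradiction x⊏y (IsStrictPartialOrder.irrefl ⊏-spo refl)
... | tri> _ _ y<x = contradiction (<⇒⊏ y<x) (IsStrictPartialOrder.asym ⊏-spo x⊏y)

module LexPrefix {a ℓ} {A : Set a} {_<_ : Rel A ℓ} (spo : IsStrictPartialOrder _≡_ _<_) where
  open IsStrictPartialOrder spo

  private
    _≺_ : Rel (List A) _
    _≺_ = Lex-< _≡_ _<_

  xs<xs++y∷ys : ∀ xs {y ys} → xs ≺ (xs ++ y ∷ ys)
  xs<xs++y∷ys []       = halt
  xs<xs++y∷ys (x ∷ xs) = next refl (xs<xs++y∷ys xs)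

  ∷ʳ-<⇔ : ∀ zs {x y} → (zs ∷ʳ x) ≺ (zs ∷ʳ y) ⇔ x < y
  ∷ʳ-<⇔ []       = mk⇔ (λ { (this x<y) → x<y ; (next _ (base ())) }) this
  ∷ʳ-<⇔ (z ∷ zs) = mk⇔
    (λ { (this z<z) → contradiction z<z (irrefl refl) ; (next _ p) → Equivalence.to (∷ʳ-<⇔ zs) p })
    (next refl ∘ Equivalence.from (∷ʳ-<⇔ zs))

  prefix-convex : ∀ zs {xs ys w} → (zs ++ xs) ≺ w → w ≺ (zs ++ ys) → ∃ λ r → w ≡ zs ++ r
  prefix-convex []       {w = w} _ _               = w , refl
  prefix-convex (z ∷ zs) (this z<w) (this w<z)       = contradiction w<z (asym z<w)
  prefix-convex (z ∷ zs) (this z<z) (next refl _)    = contradiction z<z (irrefl refl)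
  prefix-convex (z ∷ zs) (next refl _) (this z<z)    = contradiction z<z (irrefl refl)
  prefix-convex (z ∷ zs) (next refl p) (next refl q) = map₂ (cong (z ∷_)) (prefix-convex zs p q)

  data LexView (xs ys : List A) : Set (a ⊔ ℓ) where
    extension  : ∀ y r → ys ≡ xs ++ y ∷ r → LexView xs ys
    divergence : ∀ zs x y r s → xs ≡ zs ++ x ∷ r → ys ≡ zs ++ y ∷ s → x < y → LexView xs ys

  lexView : ∀ {xs ys} → xs ≺ ys → LexView xs ys
  lexView (base ())
  lexView (halt {y} {ys})              = extension y ys refl
  lexView (this {x} {xs} {y} {ys} x<y) = divergence [] x y xs ys refl refl x<y
  lexView (next {x} refl p) with lexView p
  ... | extension y r eq                = extension y r (cong (x ∷_) eq)
  ... | divergence zs x′ y r s ex ey lt = divergence (x ∷ zs) x′ y r s (cong (x ∷_) ex) (cong (x ∷_) ey) lt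

module RootPath {n : ℕ} (T : Arborescence n) where
  open Arborescence T

  pathTo : ∀ {w} → Desc parent root w → List (Fin n)
  pathTo here               = [ root ]
  pathTo (step {w = w} d _) = pathTo d ∷ʳ w

  pathTo-irrelevant : ∀ {w} (d d′ : Desc parent root w) → pathTo d ≡ pathTo d′
  pathTo-irrelevant here       here       = refl
  pathTo-irrelevant here       (step _ e) = contradiction (trans (sym root-parent) e) λ ()
  pathTo-irrelevant (step _ e) here       = contradiction (trans (sym root-parent) e) λ ()
  pathTo-irrelevant (step {w = w} d e) (step d′ e′) with just-injective (trans (sym e) e′)
  ... | refl = cong (_∷ʳ w) (pathTo-irrelevant d d′)

  pathTo-last : ∀ {w} (d : Desc parent root w) → ∃ λ xs → pathTo d ≡ xs ∷ʳ w
  pathTo-last here       = [] , refl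
  pathTo-last (step d _) = pathTo d , refl

  rootPath : Fin n → List (Fin n)
  rootPath w = pathTo (reach w)

  rootPath-root : rootPath root ≡ [ root ]
  rootPath-root = pathTo-irrelevant (reach root) here

  rootPath-step : ∀ {w p} → parent w ≡ just p → rootPath w ≡ rootPath p ∷ʳ w
  rootPath-step {w} {p} e = pathTo-irrelevant (reach w) (step (reach p) e)

  rootPath-nonempty : ∀ w → rootPath w ≢ []
  rootPath-nonempty w eq with pathTo-last (reach w)
  ... | xs , eq′ with ++-conicalʳ xs [ w ] (trans (sym eq′) eq)
  ... | ()

  rootPath-injective : Injective _≡_ _≡_ rootPath
  rootPath-injective {u} {v} eq with pathTo-last (reach u) | pathTo-last (reach v)
  ... | xs , eqᵤ | ys , eqᵥ = ∷ʳ-injectiveʳ xs ys (trans (sym eqᵤ) (trans eq eqᵥ))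

  parent≡nothing⇒root : ∀ {w} → parent w ≡ nothing → w ≡ root
  parent≡nothing⇒root {w} e with reach w
  ... | here      = refl
  ... | step _ e′ = contradiction (trans (sym e) e′) λ ()

  rootPath-init : ∀ {w} P → rootPath w ≡ P ∷ʳ w →
    (P ≡ [] × w ≡ root) ⊎ (∃ λ p → parent w ≡ just p × rootPath p ≡ P)
  rootPath-init {w} P eq with parent w in e
  ... | just p  = inj₂ (p , refl , ∷ʳ-injectiveˡ _ P (trans (sym (rootPath-step e)) eq))
  ... | nothing with parent≡nothing⇒root e
  ...   | refl = inj₁ (sym (∷ʳ-injectiveˡ [] P (trans (sym rootPath-root) eq)) , refl)

  Desc⇒rootPath-prefix : ∀ {v w} → Desc parent v w → ∃ λ r → rootPath w ≡ rootPath v ++ r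
  Desc⇒rootPath-prefix {v} here = [] , sym (++-identityʳ (rootPath v))
  Desc⇒rootPath-prefix {v} (step {w = w} d e) with Desc⇒rootPath-prefix d
  ... | r , eq = r ∷ʳ w , (begin
    rootPath w               ≡⟨ rootPath-step e ⟩
    rootPath _ ∷ʳ w          ≡⟨ cong (_∷ʳ w) eq ⟩
    (rootPath v ++ r) ∷ʳ w   ≡⟨ ++-assoc (rootPath v) r [ w ] ⟩
    rootPath v ++ r ∷ʳ w     ∎)
    where open ≡-Reasoning

  pathTo-prefix⇒ancestor : ∀ {w} (d : Desc parent root w) P x r →
    pathTo d ≡ P ++ x ∷ r → rootPath x ≡ P ∷ʳ x × Desc parent x w
  pathTo-prefix⇒ancestor here [] x r eq with ∷-injectiveˡ eq
  ... | refl = rootPath-root , here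
  pathTo-prefix⇒ancestor here (_ ∷ P) x r eq with ++-conicalʳ P (x ∷ r) (sym (∷-injectiveʳ eq))
  ... | ()
  pathTo-prefix⇒ancestor (step {w = w} d e) P x r eq with initLast r
  ... | [] with ∷ʳ-injective (pathTo d) P eq
  ...   | refl , refl = pathTo-irrelevant (reach w) (step d e) , here
  pathTo-prefix⇒ancestor (step {w = w} d e) P x _ eq | r ∷ʳ′ y
    with ∷ʳ-injective (pathTo d) (P ++ x ∷ r) (trans eq (sym (++-assoc P (x ∷ r) [ y ])))
  ... | eq′ , refl = map₂ (λ x→v → step x→v e) (pathTo-prefix⇒ancestor d P x r eq′)

  rootPath-prefix⇒ancestor : ∀ {w} P x r → rootPath w ≡ P ++ x ∷ r → rootPath x ≡ P ∷ʳ x × Desc parent x w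
  rootPath-prefix⇒ancestor {w} = pathTo-prefix⇒ancestor (reach w)

  rootPath-prefix⇒Desc : ∀ {v w} r → rootPath w ≡ rootPath v ++ r → Desc parent v w
  rootPath-prefix⇒Desc {v} {w} r eq with pathTo-last (reach v)
  ... | xs , eqᵥ = proj₂ (rootPath-prefix⇒ancestor xs v r (begin
    rootPath w          ≡⟨ eq ⟩
    rootPath v ++ r     ≡⟨ cong (_++ r) eqᵥ ⟩
    (xs ∷ʳ v) ++ r      ≡⟨ ++-assoc xs [ v ] r ⟩
    xs ++ v ∷ r         ∎))
    where open ≡-Reasoning

module CanonicalOrder {n : ℕ} (T : Arborescence n) (c : Fin n → ℕ)
    (_<V_ : Rel (Fin n) 0ℓ) (<V-isStrictTotalOrder : IsStrictTotalOrder _≡_ _<V_) where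
  open Arborescence T
  open RootPath T

  key : Fin n → Array₂ × Fin n
  key u = LDAbar T c u , u

  -- u ≺ v unfolds to  u <ᵀ v ⊎ (u =ᵀ v × u <V v),  the order the sibling rule prescribes.
  _≺_ : Rel (Fin n) 0ℓ
  _≺_ = ×-Lex _≡_ _<₂_ _<V_ on key

  ≺-isStrictTotalOrder : IsStrictTotalOrder _≡_ _≺_
  ≺-isStrictTotalOrder = on-isStrictTotalOrder-≡ key (cong proj₂)
    (×-Lex-isStrictTotalOrder-≡ <₂-isStrictTotalOrder <V-isStrictTotalOrder)

  open LexPrefix (IsStrictTotalOrder.isStrictPartialOrder ≺-isStrictTotalOrder)

  _≺ₗ_ : Rel (List (Fin n)) 0ℓ
  _≺ₗ_ = Lex-< _≡_ _≺_

  _<T_ : Rel (Fin n) 0ℓ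
  _<T_ = _≺ₗ_ on rootPath

  <T-isStrictTotalOrder : IsStrictTotalOrder _≡_ _<T_
  <T-isStrictTotalOrder = on-isStrictTotalOrder-≡ rootPath rootPath-injective
    (Lex-<-isStrictTotalOrder-≡ ≺-isStrictTotalOrder)

  open IsStrictTotalOrder <T-isStrictTotalOrder using () renaming (irrefl to <T-irrefl)

  <T-ancestor : ∀ u v → Desc parent u v → u ≢ v → u <T v
  <T-ancestor u v u→v u≢v with Desc⇒rootPath-prefix u→v
  ... | []    , eq = contradiction (rootPath-injective (trans (sym (++-identityʳ _)) (sym eq))) u≢v
  ... | _ ∷ _ , eq = subst (rootPath u ≺ₗ_) (sym eq) (xs<xs++y∷ys (rootPath u))

  <T-subtree-convex : ∀ v x y w → Desc parent v x → Desc parent v y → x <T w → w <T y → Desc parent v w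
  <T-subtree-convex v x y w v→x v→y x<w w<y
    with Desc⇒rootPath-prefix v→x | Desc⇒rootPath-prefix v→y
  ... | _ , eqₓ | _ , eqᵧ =
    rootPath-prefix⇒Desc _ (proj₂ (prefix-convex (rootPath v)
      (subst (_≺ₗ rootPath w) eqₓ x<w) (subst (rootPath w ≺ₗ_) eqᵧ w<y)))

  <T-isDFSOrder : IsDFSOrder T c _<T_
  <T-isDFSOrder = <T-ancestor , <T-subtree-convex

  <T-siblingRule : SiblingRule T c _<V_ _<T_
  <T-siblingRule u v (_ , p , pu , pv) =
    subst₂ (λ xs ys → xs ≺ₗ ys ⇔ u ≺ v) (sym (rootPath-step pu)) (sym (rootPath-step pv))
      (∷ʳ-<⇔ (rootPath p))

  <T-isCanonicalOrder : IsCanonicalOrder T c _<V_ _<T_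
  <T-isCanonicalOrder = <T-isStrictTotalOrder , <T-isDFSOrder , <T-siblingRule

  rootPath-siblings : ∀ {x y} P → x ≢ y → rootPath x ≡ P ∷ʳ x → rootPath y ≡ P ∷ʳ y → Siblings T c x y
  rootPath-siblings {x} {y} P x≢y eqₓ eqᵧ with rootPath-init P eqₓ | rootPath-init P eqᵧ
  ... | inj₁ (_ , refl)    | inj₁ (_ , refl)     = contradiction refl x≢y
  ... | inj₁ (refl , _)    | inj₂ (q , _ , eq)   = contradiction eq (rootPath-nonempty q)
  ... | inj₂ (p , _ , eq)  | inj₁ (refl , _)     = contradiction eq (rootPath-nonempty p)
  ... | inj₂ (p , pₓ , eq) | inj₂ (q , pᵧ , eq′)
    with rootPath-injective (trans eq (sym eq′))
  ...   | refl = x≢y , p , pₓ , pᵧ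

  siblings-¬Desc : ∀ {x y} → Siblings T c x y → ¬ Desc parent x y
  siblings-¬Desc {x} {y} (x≢y , p , pₓ , pᵧ) x→y with Desc⇒rootPath-prefix x→y
  ... | r , eq = x≢y (sym (∷-injectiveˡ (++-cancelˡ (rootPath p) [ y ] (x ∷ r) (begin
    rootPath p ∷ʳ y          ≡⟨ sym (rootPath-step pᵧ) ⟩
    rootPath y               ≡⟨ eq ⟩
    rootPath x ++ r          ≡⟨ cong (_++ r) (rootPath-step pₓ) ⟩
    (rootPath p ∷ʳ x) ++ r   ≡⟨ ++-assoc (rootPath p) [ x ] r ⟩
    rootPath p ++ x ∷ r      ∎))))
    where open ≡-Reasoning

  ancestor-precedes : ∀ {R : Rel (Fin n) 0ℓ} → IsDFSOrder T c R → Transitive R →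
    ∀ {x y z} → Desc parent x y → R y z → R x z
  ancestor-precedes (R-ancestor , _) R-trans {x} {y} x→y yRz with x ≟ y
  ... | yes refl = yRz
  ... | no x≢y   = R-trans (R-ancestor x y x→y x≢y) yRz

  <T⊆canonical : ∀ {R : Rel (Fin n) 0ℓ} → IsCanonicalOrder T c _<V_ R → _<T_ ⇒ R
  <T⊆canonical {R} (R-sto , R-dfs@(R-ancestor , R-convex) , R-siblingRule) {u} {v} u<v
    with lexView u<v
  ... | extension _ r eq = R-ancestor u v (rootPath-prefix⇒Desc _ eq) λ { refl → <T-irrefl refl u<v }
  ... | divergence P x y r s eqᵤ eqᵥ x≺y
    with rootPath-prefix⇒ancestor P x r eqᵤ | rootPath-prefix⇒ancestor P y s eqᵥ
         | IsStrictTotalOrder.compare R-sto u v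
  ... | _ | _ | tri< uRv _ _ = uRv
  ... | _ | _ | tri≈ _ refl _ = contradiction u<v (<T-irrefl refl)
  ... | eqₓ , x→u | eqᵧ , y→v | tri> _ _ vRu =
    contradiction (R-convex x x u y here x→u xRy yRu) (siblings-¬Desc x~y)
    where
    x~y : Siblings T c x y
    x~y = rootPath-siblings P (λ { refl → IsStrictTotalOrder.irrefl ≺-isStrictTotalOrder refl x≺y }) eqₓ eqᵧ

    xRy : R x y
    xRy = Equivalence.from (R-siblingRule x y x~y) x≺y

    yRu : R y u
    yRu = ancestor-precedes R-dfs (IsStrictTotalOrder.trans R-sto) y→v vRu

proposition3p6 : ∀ {n : ℕ} (T : Arborescence n) (c : Fin n → ℕ)
    (_<V_ : Rel (Fin n) 0ℓ) → IsStrictTotalOrder _≡_ _<V_ →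
    ∃ λ (_<T_ : Rel (Fin n) 0ℓ) →
      IsCanonicalOrder T c _<V_ _<T_
      × (∀ (R : Rel (Fin n) 0ℓ) → IsCanonicalOrder T c _<V_ R →
           ∀ u v → (R u v ⇔ (u <T v)))
proposition3p6 T c _<V_ <V-isStrictTotalOrder =
  _<T_ , <T-isCanonicalOrder , λ R R-canonical _ _ →
    mk⇔ (strictTotalOrder-maximal <T-isStrictTotalOrder
           (IsStrictTotalOrder.isStrictPartialOrder (proj₁ R-canonical)) (<T⊆canonical R-canonical))
        (<T⊆canonical R-canonical)
  where open CanonicalOrder T c _<V_ <V-isStrictTotalOrder
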